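{- Let $G$ be a graph and let $x$ be a chip-distribution on $G$. If there exists an acyclic orientation $D$ of $G$ such that $x(v)\le d^-_D(v)$ for every $v\in V(G)$, then ${\rm dist}(x)=|E(G)|-|x|$.
   Context: A graph is a connected undirected graph, possibly with multiple edges but no loops; $|E(G)|$ counts edges with multiplicity; $d(v)$ is the degree. An orientation of $G$ directs each edge; $d^-_D(v)$ is the indegree of $v$ in the orientation $D$. A chip-distribution is $x:V(G)\to\mathbb{Z}_{\ge0}$, $|x|=\sum_vx(v)$. A vertex $v$ is active if $x(v)\ge d(v)$; firing $v$ removes $d(v)$ chips from $v$ and sends one chip along each incident edge. A legal game is a sequence of firings of active vertices; a distribution is non-terminating if every legal game from it can be continued indefinitely (otherwise every legal game from it terminates). ${\rm dist}(x)=\min\{|y| : y \text{ chip-distribution}, x+y \text{ non-terminating}\}$. -}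

module Defs where

open import Data.Nat using (ℕ; zero; suc; _+_; _∸_; _≤_)
open import Data.Fin using (Fin)
open import Data.Fin.Properties using (_≟_)
open import Data.Bool using (Bool; true; false)
open import Data.Product using (_×_; _,_; proj₁; proj₂; Σ; ∃)
open import Data.Sum using (_⊎_)
open import Data.Vec.Functional using (foldr)
open import Relation.Nullary using (¬_; yes; no)
open import Relation.Binary.PropositionalEquality using (_≡_; _≢_)

Σ[_] : ∀ {k} → (Fin k → ℕ) → ℕ
Σ[ f ] = foldr _+_ 0 f

[_≟ᵛ_] : ∀ {n} → Fin n → Fin n → ℕ
[ u ≟ᵛ v ] with u ≟ v
... | yes _ = 1
... | no  _ = 0

-- A (multi)graph with vertex set Fin n and edge set Fin m; edge e has
-- endpoints ends e.  Multiple edges are allowed, loops are not; the graph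
-- is nonempty and connected.
record Graph : Set where
  field
    n        : ℕ
    m        : ℕ
    ends     : Fin m → Fin n × Fin n
    loopless : ∀ e → proj₁ (ends e) ≢ proj₂ (ends e)

  V : Set
  V = Fin n

  E : Set
  E = Fin m

  -- degree: number of edges incident to v (loopless, so each counts once)
  deg : V → ℕ
  deg v = Σ[ (λ e → [ v ≟ᵛ proj₁ (ends e) ] + [ v ≟ᵛ proj₂ (ends e) ]) ]

  Adj : V → V → Set
  Adj u v = ∃ λ e → (proj₁ (ends e) ≡ u × proj₂ (ends e) ≡ v)
                  ⊎ (proj₁ (ends e) ≡ v × proj₂ (ends e) ≡ u)

data Connects (G : Graph) : Graph.V G → Graph.V G → Set where
  here  : ∀ {v} → Connects G v v
  there : ∀ {u w v} → Graph.Adj G u w → Connects G w v → Connects G u v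

Connected : Graph → Set
Connected G = ∀ u v → Connects G u v

Nonempty : Graph → Set
Nonempty G = Fin (Graph.n G)

module _ (G : Graph) where
  open Graph G

  ∣E∣ : ℕ
  ∣E∣ = m

  -- An orientation: for each edge, true = directed from proj₁ to proj₂,
  -- false = directed from proj₂ to proj₁.
  Orientation : Set
  Orientation = E → Bool

  tail head : Orientation → E → V
  tail D e with D e
  ... | true  = proj₁ (ends e)
  ... | false = proj₂ (ends e)
  head D e with D e
  ... | true  = proj₂ (ends e)
  ... | false = proj₁ (ends e)

  indeg : Orientation → V → ℕ
  indeg D v = Σ[ (λ e → [ v ≟ᵛ head D e ]) ]

  data DPath (D : Orientation) : V → V → Set where
    step : ∀ e → DPath D (tail D e) (head D e)
    _∷ᵈ_ : ∀ e {v} → DPath D (head D e) v → DPath D (tail D e) v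

  Acyclic : Orientation → Set
  Acyclic D = ∀ v → ¬ DPath D v v

  ChipDist : Set
  ChipDist = V → ℕ

  ∣_∣ : ChipDist → ℕ
  ∣ x ∣ = Σ[ x ]

  _⊕_ : ChipDist → ChipDist → ChipDist
  (x ⊕ y) v = x v + y v

  Active : ChipDist → V → Set
  Active x v = deg v ≤ x v

  edgesBetween : V → V → ℕ
  edgesBetween u w = Σ[ edgeUW ]
    where
      edgeUW : E → ℕ
      edgeUW e with u ≟ proj₁ (ends e) | w ≟ proj₂ (ends e)
                  | u ≟ proj₂ (ends e) | w ≟ proj₁ (ends e)
      ... | yes _ | yes _ | _ | _ = 1
      ... | _ | _ | yes _ | yes _ = 1
      ... | _ | _ | _ | _ = 0

  fire : ChipDist → V → ChipDist
  fire x v w with w ≟ v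
  ... | yes _ = x w ∸ deg v
  ... | no  _ = x w + edgesBetween v w

  data Step (x : ChipDist) : ChipDist → Set where
    fires : ∀ v → Active x v → Step x (fire x v)

  data Reach (x : ChipDist) : ChipDist → Set where
    done : Reach x x
    more : ∀ {y z} → Step x y → Reach y z → Reach x z

  -- non-terminating: every legal game can be continued, i.e. every
  -- distribution reached by a legal game has an active vertex
  NonTerminating : ChipDist → Set
  NonTerminating x = ∀ y → Reach x y → ∃ λ v → Active y v

  IsDist : ChipDist → ℕ → Set
  IsDist x k = (∃ λ y → ∣ y ∣ ≡ k × NonTerminating (x ⊕ y))
             × (∀ y → NonTerminating (x ⊕ y) → k ≤ ∣ y ∣)

module Submission where

-- The indegree vector of an acyclic orientation D has a sink, which is active; firing
-- it yields the indegree vector of D with that sink turned into a source, again acyclic.  So topping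
-- x up to indeg_D costs |E| - |x| chips and gives a game that never stops.
--
-- Follow an infinite game from a distribution z.  A vertex has received at most |z|
-- chips more than it has sent, so along any path a neighbour of a vertex that fired f times fired
-- at most |z| + f·deg times; on a connected graph every vertex has therefore fired after boundedly
-- many steps.  A vertex still holds every chip sent to it by neighbours that fired after its own
-- last firing, and once all vertices have fired (at distinct times) each edge accounts for such a
-- chip at its earlier endpoint, so |z| ≥ |E|.

open import Defs
open import Data.Nat using (ℕ; _∸_; _≤_; zero; suc; _+_; _*_; _<_; _<?_; z≤n; s≤s)
open import Data.Product using (∃; _×_; _,_; proj₁; proj₂; ∃₂)

open import Data.Nat.Properties as ℕ
  using (≤-trans; ≤-reflexive; +-comm; +-assoc; +-identityʳ; *-identityʳ; *-zeroʳ; +-mono-≤; +-monoˡ-≤; +-monoʳ-≤)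
open import Data.Bool using (true; false)
open import Data.Fin as Fin using (Fin; zero; suc; toℕ)
open import Data.Fin.Properties using (_≟_; suc-injective; pigeonhole; any?; all?; ¬∀⟶∃¬)
open import Data.Sum using (_⊎_; inj₁; inj₂)
open import Data.Vec.Functional using (updateAt)
open import Data.Vec.Functional.Properties using (updateAt-updates; updateAt-minimal)
open import Function using (_∘_)
open import Relation.Nullary using (¬_; Dec; yes; no; ¬?; contradiction)
open import Relation.Nullary.Decidable using (_⊎-dec_; decidable-stable)
open import Relation.Binary.PropositionalEquality
  using (_≡_; _≢_; _≗_; ≢-sym; refl; sym; trans; cong; cong₂; subst; subst₂; module ≡-Reasoning)
open import Algebra.Properties.Semiring.Sum ℕ.+-*-semiring
  using (sum-cong-≗; sum-replicate-zero; ∑-distrib-+; ∑-comm; *-distribˡ-sum; *-distribʳ-sum)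
open import Algebra.Properties.CommutativeSemigroup ℕ.+-commutativeSemigroup using (x∙yz≈xz∙y; xy∙z≈xz∙y)

-- Lemma names write δ for the Kronecker delta [ i ≟ᵛ j ].

δ≡1 : ∀ {k} {i j : Fin k} → i ≡ j → [ i ≟ᵛ j ] ≡ 1
δ≡1 {i = i} {j} i≡j with i ≟ j
... | yes _  = refl
... | no i≢j = contradiction i≡j i≢j

δ≡0 : ∀ {k} {i j : Fin k} → i ≢ j → [ i ≟ᵛ j ] ≡ 0
δ≡0 {i = i} {j} i≢j with i ≟ j
... | yes i≡j = contradiction i≡j i≢j
... | no _    = refl

δ-suc : ∀ {k} (i j : Fin k) → [ suc i ≟ᵛ suc j ] ≡ [ i ≟ᵛ j ]
δ-suc i j = by-cases (i ≟ j)
  where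
  by-cases : Dec (i ≡ j) → [ suc i ≟ᵛ suc j ] ≡ [ i ≟ᵛ j ]
  by-cases (yes i≡j) = trans (δ≡1 (cong suc i≡j)) (sym (δ≡1 i≡j))
  by-cases (no i≢j)  = trans (δ≡0 (λ si≡sj → i≢j (suc-injective si≡sj))) (sym (δ≡0 i≢j))

δ*-subst : ∀ {k} (i j : Fin k) (g : Fin k → ℕ) → [ i ≟ᵛ j ] * g i ≡ [ i ≟ᵛ j ] * g j
δ*-subst i j g with i ≟ j
... | yes refl = refl
... | no _     = refl

[_<ᵗ_] : ℕ → ℕ → ℕ
[ a <ᵗ b ] with a <? b
... | yes _ = 1
... | no _  = 0

<ᵗ≤1 : ∀ a b → [ a <ᵗ b ] ≤ 1
<ᵗ≤1 a b with a <? b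
... | yes _ = s≤s z≤n
... | no _  = z≤n

≮⇒<ᵗ≡0 : ∀ {a b} → ¬ a < b → [ a <ᵗ b ] ≡ 0
≮⇒<ᵗ≡0 {a} {b} a≮b with a <? b
... | yes a<b = contradiction a<b a≮b
... | no _    = refl

≢⇒1≤<ᵗ+<ᵗ : ∀ {a b} → a ≢ b → 1 ≤ [ a <ᵗ b ] + [ b <ᵗ a ]
≢⇒1≤<ᵗ+<ᵗ {a} {b} a≢b with a <? b | b <? a
... | yes _  | _      = s≤s z≤n
... | no _   | yes _  = s≤s z≤n
... | no a≮b | no b≮a = contradiction (ℕ.≤-antisym (ℕ.≮⇒≥ b≮a) (ℕ.≮⇒≥ a≮b)) a≢b

Σ-mono-≤ : ∀ {k} {f g : Fin k → ℕ} → (∀ i → f i ≤ g i) → Σ[ f ] ≤ Σ[ g ]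
Σ-mono-≤ {zero}  f≤g = z≤n
Σ-mono-≤ {suc k} f≤g = +-mono-≤ (f≤g zero) (Σ-mono-≤ (λ i → f≤g (suc i)))

≤-Σ : ∀ {k} (f : Fin k → ℕ) (i : Fin k) → f i ≤ Σ[ f ]
≤-Σ f zero    = ℕ.m≤m+n _ _
≤-Σ f (suc i) = ≤-trans (≤-Σ (λ j → f (suc j)) i) (ℕ.m≤n+m _ _)

Σ-zero : ∀ {k} {f : Fin k → ℕ} → (∀ i → f i ≡ 0) → Σ[ f ] ≡ 0
Σ-zero {k} f≡0 = trans (sum-cong-≗ f≡0) (sum-replicate-zero k)

Σ-one : ∀ {k} → Σ[ (λ (_ : Fin k) → 1) ] ≡ k
Σ-one {zero}  = refl
Σ-one {suc k} = cong suc (Σ-one {k})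

Σ-δ* : ∀ {k} (j : Fin k) (g : Fin k → ℕ) → Σ[ (λ i → [ i ≟ᵛ j ] * g i) ] ≡ g j
Σ-δ* zero    g = trans (cong₂ _+_ (+-identityʳ (g zero)) (Σ-zero {f = λ i → [ suc i ≟ᵛ zero ] * g (suc i)} (λ _ → refl)))
                       (+-identityʳ (g zero))
Σ-δ* (suc j) g = trans (sum-cong-≗ (λ i → cong (_* g (suc i)) (δ-suc i j))) (Σ-δ* j (λ i → g (suc i)))

Σ-δ : ∀ {k} (j : Fin k) → Σ[ (λ i → [ i ≟ᵛ j ]) ] ≡ 1
Σ-δ j = trans (sum-cong-≗ (λ i → sym (*-identityʳ [ i ≟ᵛ j ]))) (Σ-δ* j (λ _ → 1))

Σ-∸ : ∀ {k} (f g : Fin k → ℕ) → (∀ i → g i ≤ f i) → Σ[ (λ i → f i ∸ g i) ] ≡ Σ[ f ] ∸ Σ[ g ]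
Σ-∸ f g g≤f = begin
  Σ[ (λ i → f i ∸ g i) ]                    ≡⟨ ℕ.m+n∸n≡m _ Σ[ g ] ⟨
  Σ[ (λ i → f i ∸ g i) ] + Σ[ g ] ∸ Σ[ g ]  ≡⟨ cong (_∸ Σ[ g ]) (∑-distrib-+ (λ i → f i ∸ g i) g) ⟨
  Σ[ (λ i → f i ∸ g i + g i) ] ∸ Σ[ g ]
    ≡⟨ cong (_∸ Σ[ g ]) (sum-cong-≗ (λ i → ℕ.m∸n+n≡m (g≤f i))) ⟩
  Σ[ f ] ∸ Σ[ g ]                           ∎
  where open ≡-Reasoning

Σ-≤-rigid : ∀ {k} (f g : Fin k → ℕ) → (∀ i → f i ≤ g i) → Σ[ g ] ≤ Σ[ f ] → ∀ i → f i ≡ g i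
Σ-≤-rigid f g f≤g Σg≤Σf zero = ℕ.≤-antisym (f≤g zero)
  (ℕ.+-cancelʳ-≤ _ _ _ (≤-trans Σg≤Σf (+-monoʳ-≤ (f zero) (Σ-mono-≤ (λ i → f≤g (suc i))))))
Σ-≤-rigid f g f≤g Σg≤Σf (suc i) = Σ-≤-rigid (λ j → f (suc j)) (λ j → g (suc j)) (λ j → f≤g (suc j))
  (ℕ.+-cancelˡ-≤ (g zero) _ _ (≤-trans Σg≤Σf (+-monoˡ-≤ _ (f≤g zero)))) i

module _ (G : Graph) where
  open Graph G

  e₁ e₂ : E → V
  e₁ e = proj₁ (ends e)
  e₂ e = proj₂ (ends e)

  inc : V → E → ℕ
  inc v e = [ v ≟ᵛ e₁ e ] + [ v ≟ᵛ e₂ e ]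

  joins : V → V → E → ℕ
  joins v w e = [ v ≟ᵛ e₁ e ] * [ w ≟ᵛ e₂ e ] + [ v ≟ᵛ e₂ e ] * [ w ≟ᵛ e₁ e ]

  edgesBetween≡Σjoins : ∀ v w → edgesBetween G v w ≡ Σ[ joins v w ]
  edgesBetween≡Σjoins v w = trans (sym unfold) (sum-cong-≗ summand≡joins)
    where
    -- The summand of edgesBetween is local to Defs; unification against unfold names it.
    summand : E → ℕ
    summand = _
    unfold : Σ[ summand ] ≡ edgesBetween G v w
    unfold = refl
    summand≡joins : summand ≗ joins v w
    summand≡joins e with v ≟ e₁ e | w ≟ e₂ e | v ≟ e₂ e | w ≟ e₁ e
    ... | yes p | yes q | yes c | _     = contradiction (trans (sym p) c) (loopless e)
    ... | yes p | yes q | no c  | _     = refl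
    ... | yes p | no q  | yes c | yes d = refl
    ... | yes p | no q  | yes c | no d  = refl
    ... | yes p | no q  | no c  | _     = refl
    ... | no p  | _     | yes c | yes d = refl
    ... | no p  | _     | yes c | no d  = refl
    ... | no p  | _     | no c  | _     = refl

  δ₁*δ₂≡0 : ∀ v e → [ v ≟ᵛ e₁ e ] * [ v ≟ᵛ e₂ e ] ≡ 0
  δ₁*δ₂≡0 v e = by-cases (v ≟ e₁ e)
    where
    by-cases : Dec (v ≡ e₁ e) → [ v ≟ᵛ e₁ e ] * [ v ≟ᵛ e₂ e ] ≡ 0
    by-cases (yes v≡e₁) rewrite δ≡0 (λ v≡e₂ → loopless e (trans (sym v≡e₁) v≡e₂)) = *-zeroʳ [ v ≟ᵛ e₁ e ]
    by-cases (no v≢e₁)  rewrite δ≡0 v≢e₁ = refl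

  joins-sym : ∀ v w e → joins v w e ≡ joins w v e
  joins-sym v w e = trans (+-comm (a * d) (c * b)) (cong₂ _+_ (ℕ.*-comm c b) (ℕ.*-comm a d))
    where
    a b c d : ℕ
    a = [ v ≟ᵛ e₁ e ]
    b = [ w ≟ᵛ e₁ e ]
    c = [ v ≟ᵛ e₂ e ]
    d = [ w ≟ᵛ e₂ e ]

  edgesBetween-sym : ∀ v w → edgesBetween G v w ≡ edgesBetween G w v
  edgesBetween-sym v w = begin
    edgesBetween G v w  ≡⟨ edgesBetween≡Σjoins v w ⟩
    Σ[ joins v w ]      ≡⟨ sum-cong-≗ (joins-sym v w) ⟩
    Σ[ joins w v ]      ≡⟨ edgesBetween≡Σjoins w v ⟨
    edgesBetween G w v  ∎
    where open ≡-Reasoning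

  edgesBetween-self : ∀ v → edgesBetween G v v ≡ 0
  edgesBetween-self v = trans (edgesBetween≡Σjoins v v) (Σ-zero joins-self)
    where
    joins-self : ∀ e → joins v v e ≡ 0
    joins-self e = cong₂ _+_ (δ₁*δ₂≡0 v e) (trans (ℕ.*-comm [ v ≟ᵛ e₂ e ] _) (δ₁*δ₂≡0 v e))

  Adj⇒1≤edgesBetween : ∀ {a b} → Adj a b → 1 ≤ edgesBetween G b a
  Adj⇒1≤edgesBetween {a} {b} (e , ends≡) =
    ≤-trans (one ends≡) (≤-trans (≤-Σ (joins b a) e) (≤-reflexive (sym (edgesBetween≡Σjoins b a))))
    where
    one : (e₁ e ≡ a × e₂ e ≡ b) ⊎ (e₁ e ≡ b × e₂ e ≡ a) → 1 ≤ joins b a e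
    one (inj₁ (e₁≡a , e₂≡b)) rewrite δ≡1 (sym e₂≡b) | δ≡1 (sym e₁≡a) = ℕ.m≤n+m 1 _
    one (inj₂ (e₁≡b , e₂≡a)) rewrite δ≡1 (sym e₁≡b) | δ≡1 (sym e₂≡a) = ℕ.m≤m+n 1 _

  Σ-joins* : ∀ v e (g : V → ℕ) →
             Σ[ (λ w → joins v w e * g w) ] ≡ [ v ≟ᵛ e₁ e ] * g (e₂ e) + [ v ≟ᵛ e₂ e ] * g (e₁ e)
  Σ-joins* v e g = begin
    Σ[ (λ w → joins v w e * g w) ]
      ≡⟨ sum-cong-≗ distribute ⟩
    Σ[ (λ w → a * ([ w ≟ᵛ e₂ e ] * g w) + c * ([ w ≟ᵛ e₁ e ] * g w)) ]
      ≡⟨ ∑-distrib-+ (λ w → a * ([ w ≟ᵛ e₂ e ] * g w)) (λ w → c * ([ w ≟ᵛ e₁ e ] * g w)) ⟩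
    Σ[ (λ w → a * ([ w ≟ᵛ e₂ e ] * g w)) ] + Σ[ (λ w → c * ([ w ≟ᵛ e₁ e ] * g w)) ]
      ≡⟨ cong₂ _+_ (pull a (e₂ e)) (pull c (e₁ e)) ⟩
    a * g (e₂ e) + c * g (e₁ e)
      ∎
    where
    open ≡-Reasoning
    a c : ℕ
    a = [ v ≟ᵛ e₁ e ]
    c = [ v ≟ᵛ e₂ e ]
    distribute : ∀ w → joins v w e * g w ≡ a * ([ w ≟ᵛ e₂ e ] * g w) + c * ([ w ≟ᵛ e₁ e ] * g w)
    distribute w = trans (ℕ.*-distribʳ-+ (g w) (a * _) (c * _))
                         (cong₂ _+_ (ℕ.*-assoc a _ (g w)) (ℕ.*-assoc c _ (g w)))
    pull : ∀ k u → Σ[ (λ w → k * ([ w ≟ᵛ u ] * g w)) ] ≡ k * g u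
    pull k u = trans (sym (*-distribˡ-sum k (λ w → [ w ≟ᵛ u ] * g w))) (cong (k *_) (Σ-δ* u g))

  Σ-edgesBetween* : ∀ v (g : V → ℕ) → Σ[ (λ w → edgesBetween G v w * g w) ]
                    ≡ Σ[ (λ e → [ v ≟ᵛ e₁ e ] * g (e₂ e) + [ v ≟ᵛ e₂ e ] * g (e₁ e)) ]
  Σ-edgesBetween* v g = begin
    Σ[ (λ w → edgesBetween G v w * g w) ]        ≡⟨ sum-cong-≗ (λ w → cong (_* g w) (edgesBetween≡Σjoins v w)) ⟩
    Σ[ (λ w → Σ[ joins v w ] * g w) ]            ≡⟨ sum-cong-≗ (λ w → *-distribʳ-sum (g w) (joins v w)) ⟩
    Σ[ (λ w → Σ[ (λ e → joins v w e * g w) ]) ]  ≡⟨ ∑-comm (λ w e → joins v w e * g w) ⟩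
    Σ[ (λ e → Σ[ (λ w → joins v w e * g w) ]) ]  ≡⟨ sum-cong-≗ (λ e → Σ-joins* v e g) ⟩
    Σ[ (λ e → [ v ≟ᵛ e₁ e ] * g (e₂ e) + [ v ≟ᵛ e₂ e ] * g (e₁ e)) ] ∎
    where open ≡-Reasoning

  Σ-edgesBetween : ∀ v → Σ[ edgesBetween G v ] ≡ deg v
  Σ-edgesBetween v = begin
    Σ[ edgesBetween G v ]                        ≡⟨ sum-cong-≗ (λ w → *-identityʳ (edgesBetween G v w)) ⟨
    Σ[ (λ w → edgesBetween G v w * 1) ]          ≡⟨ Σ-edgesBetween* v (λ _ → 1) ⟩
    Σ[ (λ e → [ v ≟ᵛ e₁ e ] * 1 + [ v ≟ᵛ e₂ e ] * 1) ]
      ≡⟨ sum-cong-≗ (λ e → cong₂ _+_ (*-identityʳ [ v ≟ᵛ e₁ e ]) (*-identityʳ [ v ≟ᵛ e₂ e ])) ⟩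
    deg v                                        ∎
    where open ≡-Reasoning

  fire-self : ∀ c v → fire G c v v ≡ c v ∸ deg v
  fire-self c v with v ≟ v
  ... | yes _  = refl
  ... | no v≢v = contradiction refl v≢v

  fire-other : ∀ c v w → w ≢ v → fire G c v w ≡ c w + edgesBetween G v w
  fire-other c v w w≢v with w ≟ v
  ... | yes w≡v = contradiction w≡v w≢v
  ... | no _    = refl

  fire-equation : ∀ c v → Active G c v → ∀ w → fire G c v w + [ w ≟ᵛ v ] * deg v ≡ c w + edgesBetween G v w
  fire-equation c v active w = by-cases (w ≟ v)
    where
    by-cases : Dec (w ≡ v) → fire G c v w + [ w ≟ᵛ v ] * deg v ≡ c w + edgesBetween G v w
    by-cases (yes refl) rewrite fire-self c v | δ≡1 {i = v} refl | edgesBetween-self v =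
      trans (cong (c v ∸ deg v +_) (+-identityʳ (deg v))) (trans (ℕ.m∸n+n≡m active) (sym (+-identityʳ (c v))))
    by-cases (no w≢v) rewrite fire-other c v w w≢v | δ≡0 w≢v = +-identityʳ _

  Σ-fire : ∀ c v → Active G c v → Σ[ fire G c v ] ≡ Σ[ c ]
  Σ-fire c v active = ℕ.+-cancelʳ-≡ (deg v) _ _ (begin
    Σ[ fire G c v ] + deg v                            ≡⟨ cong (Σ[ fire G c v ] +_) (Σ-δ* v (λ _ → deg v)) ⟨
    Σ[ fire G c v ] + Σ[ (λ w → [ w ≟ᵛ v ] * deg v) ]  ≡⟨ ∑-distrib-+ (fire G c v) (λ w → [ w ≟ᵛ v ] * deg v) ⟨
    Σ[ (λ w → fire G c v w + [ w ≟ᵛ v ] * deg v) ]     ≡⟨ sum-cong-≗ (fire-equation c v active) ⟩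
    Σ[ (λ w → c w + edgesBetween G v w) ]              ≡⟨ ∑-distrib-+ c (edgesBetween G v) ⟩
    Σ[ c ] + Σ[ edgesBetween G v ]                     ≡⟨ cong (Σ[ c ] +_) (Σ-edgesBetween v) ⟩
    Σ[ c ] + deg v                                     ∎)
    where open ≡-Reasoning

  Σ-reach : ∀ {x y} → Reach G x y → Σ[ y ] ≡ Σ[ x ]
  Σ-reach done                          = refl
  Σ-reach (more (fires v active) x⇝y) = trans (Σ-reach x⇝y) (Σ-fire _ v active)

  reach-snoc : ∀ {x y z} → Reach G x y → Step G y z → Reach G x z
  reach-snoc done         y→z = more y→z done
  reach-snoc (more s x⇝y) y→z = more s (reach-snoc x⇝y y→z)

  handshake : ∀ (g : V → V → ℕ) → Σ[ (λ v → Σ[ (λ u → edgesBetween G v u * g v u) ]) ]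
                     ≡ Σ[ (λ e → g (e₁ e) (e₂ e) + g (e₂ e) (e₁ e)) ]
  handshake g = begin
    Σ[ (λ v → Σ[ (λ u → edgesBetween G v u * g v u) ]) ]
      ≡⟨ sum-cong-≗ (λ v → Σ-edgesBetween* v (g v)) ⟩
    Σ[ (λ v → Σ[ (λ e → [ v ≟ᵛ e₁ e ] * g v (e₂ e) + [ v ≟ᵛ e₂ e ] * g v (e₁ e)) ]) ]
      ≡⟨ ∑-comm (λ v e → [ v ≟ᵛ e₁ e ] * g v (e₂ e) + [ v ≟ᵛ e₂ e ] * g v (e₁ e)) ⟩
    Σ[ (λ e → Σ[ (λ v → [ v ≟ᵛ e₁ e ] * g v (e₂ e) + [ v ≟ᵛ e₂ e ] * g v (e₁ e)) ]) ]
      ≡⟨ sum-cong-≗ (λ e → ∑-distrib-+ (λ v → [ v ≟ᵛ e₁ e ] * g v (e₂ e))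
                                       (λ v → [ v ≟ᵛ e₂ e ] * g v (e₁ e))) ⟩
    Σ[ (λ e → Σ[ (λ v → [ v ≟ᵛ e₁ e ] * g v (e₂ e)) ] + Σ[ (λ v → [ v ≟ᵛ e₂ e ] * g v (e₁ e)) ]) ]
      ≡⟨ sum-cong-≗ (λ e → cong₂ _+_ (Σ-δ* (e₁ e) (λ v → g v (e₂ e)))
                                     (Σ-δ* (e₂ e) (λ v → g v (e₁ e)))) ⟩
    Σ[ (λ e → g (e₁ e) (e₂ e) + g (e₂ e) (e₁ e)) ]  ∎
    where open ≡-Reasoning

  -- Acyclic orientations

  head-tail-ends : ∀ D e → (head G D e ≡ e₁ e × tail G D e ≡ e₂ e) ⊎ (head G D e ≡ e₂ e × tail G D e ≡ e₁ e)
  head-tail-ends D e with D e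
  ... | true  = inj₂ (refl , refl)
  ... | false = inj₁ (refl , refl)

  head≢tail : ∀ D e → head G D e ≢ tail G D e
  head≢tail D e h≡t with head-tail-ends D e
  ... | inj₁ (h≡e₁ , t≡e₂) = loopless e (trans (sym h≡e₁) (trans h≡t t≡e₂))
  ... | inj₂ (h≡e₂ , t≡e₁) = loopless e (trans (sym t≡e₁) (trans (sym h≡t) h≡e₂))

  end⇒head⊎tail : ∀ D {v} e → v ≡ e₁ e ⊎ v ≡ e₂ e → v ≡ head G D e ⊎ v ≡ tail G D e
  end⇒head⊎tail D e end with head-tail-ends D e | end
  ... | inj₁ (h≡e₁ , _) | inj₁ v≡e₁ = inj₁ (trans v≡e₁ (sym h≡e₁))
  ... | inj₁ (_ , t≡e₂) | inj₂ v≡e₂ = inj₂ (trans v≡e₂ (sym t≡e₂))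
  ... | inj₂ (_ , t≡e₁) | inj₁ v≡e₁ = inj₂ (trans v≡e₁ (sym t≡e₁))
  ... | inj₂ (h≡e₂ , _) | inj₂ v≡e₂ = inj₁ (trans v≡e₂ (sym h≡e₂))

  same-direction : ∀ D D′ e → D e ≡ D′ e → tail G D e ≡ tail G D′ e × head G D e ≡ head G D′ e
  same-direction D D′ e eq with D e | D′ e
  ... | true  | true  = refl , refl
  ... | false | false = refl , refl
  ... | true  | false = contradiction eq λ ()
  ... | false | true  = contradiction eq λ ()

  inc≡δhead+δtail : ∀ D v e → inc v e ≡ [ v ≟ᵛ head G D e ] + [ v ≟ᵛ tail G D e ]
  inc≡δhead+δtail D v e with head-tail-ends D e
  ... | inj₁ (h≡e₁ , t≡e₂) rewrite h≡e₁ | t≡e₂ = refl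
  ... | inj₂ (h≡e₂ , t≡e₁) rewrite h≡e₂ | t≡e₁ = +-comm [ v ≟ᵛ e₁ e ] [ v ≟ᵛ e₂ e ]

  joins≡tail-head : ∀ D v w e → joins v w e
                    ≡ [ v ≟ᵛ tail G D e ] * [ w ≟ᵛ head G D e ] + [ v ≟ᵛ head G D e ] * [ w ≟ᵛ tail G D e ]
  joins≡tail-head D v w e with head-tail-ends D e
  ... | inj₁ (h≡e₁ , t≡e₂) rewrite h≡e₁ | t≡e₂ = +-comm ([ v ≟ᵛ e₁ e ] * [ w ≟ᵛ e₂ e ]) _
  ... | inj₂ (h≡e₂ , t≡e₁) rewrite h≡e₂ | t≡e₁ = refl

  Σ-indeg : ∀ D → Σ[ indeg G D ] ≡ m
  Σ-indeg D = begin
    Σ[ (λ v → Σ[ (λ e → [ v ≟ᵛ head G D e ]) ]) ]  ≡⟨ ∑-comm (λ v e → [ v ≟ᵛ head G D e ]) ⟩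
    Σ[ (λ e → Σ[ (λ v → [ v ≟ᵛ head G D e ]) ]) ]  ≡⟨ sum-cong-≗ (λ e → Σ-δ (head G D e)) ⟩
    Σ[ (λ (_ : E) → 1) ]                           ≡⟨ Σ-one ⟩
    m                                              ∎
    where open ≡-Reasoning

  IsSink : Orientation G → V → Set
  IsSink D v = ∀ e → tail G D e ≢ v

  sink⇒δhead≡inc : ∀ D {v} → IsSink D v → ∀ e → [ v ≟ᵛ head G D e ] ≡ inc v e
  sink⇒δhead≡inc D {v} sink e = sym (begin
    inc v e                                          ≡⟨ inc≡δhead+δtail D v e ⟩
    [ v ≟ᵛ head G D e ] + [ v ≟ᵛ tail G D e ]        ≡⟨ cong ([ v ≟ᵛ head G D e ] +_) (δ≡0 (≢-sym (sink e))) ⟩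
    [ v ≟ᵛ head G D e ] + 0                          ≡⟨ +-identityʳ _ ⟩
    [ v ≟ᵛ head G D e ]                              ∎)
    where open ≡-Reasoning

  sink⇒indeg≡deg : ∀ D {v} → IsSink D v → indeg G D v ≡ deg v
  sink⇒indeg≡deg D sink = sum-cong-≗ (sink⇒δhead≡inc D sink)

  deg≤indeg⇒sink : ∀ D {v} → deg v ≤ indeg G D v → IsSink D v
  deg≤indeg⇒sink D {v} deg≤indeg e tail≡v = contradiction (trans (sym (δ≡1 (sym tail≡v))) δtail≡0) λ ()
    where
    δhead≤inc : ∀ e → [ v ≟ᵛ head G D e ] ≤ inc v e
    δhead≤inc e = ≤-trans (ℕ.m≤m+n _ _) (≤-reflexive (sym (inc≡δhead+δtail D v e)))
    δhead≡δhead+δtail : [ v ≟ᵛ head G D e ] ≡ [ v ≟ᵛ head G D e ] + [ v ≟ᵛ tail G D e ]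
    δhead≡δhead+δtail = trans (Σ-≤-rigid _ (inc v) δhead≤inc deg≤indeg e) (inc≡δhead+δtail D v e)
    δtail≡0 : [ v ≟ᵛ tail G D e ] ≡ 0
    δtail≡0 = ℕ.+-cancelˡ-≡ [ v ≟ᵛ head G D e ] _ 0 (trans (sym δhead≡δhead+δtail) (sym (+-identityʳ _)))

  makeSource : Orientation G → V → Orientation G
  makeSource D v e with v ≟ e₁ e | v ≟ e₂ e
  ... | yes _ | _     = true
  ... | no _  | yes _ = false
  ... | no _  | no _  = D e

  tail-makeSource : ∀ D {v} e → v ≡ e₁ e ⊎ v ≡ e₂ e → tail G (makeSource D v) e ≡ v
  tail-makeSource D {v} e end with v ≟ e₁ e | v ≟ e₂ e | end
  ... | yes v≡e₁ | _        | _         = sym v≡e₁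
  ... | no _     | yes v≡e₂ | _         = sym v≡e₂
  ... | no v≢e₁  | no _     | inj₁ v≡e₁ = contradiction v≡e₁ v≢e₁
  ... | no _     | no v≢e₂  | inj₂ v≡e₂ = contradiction v≡e₂ v≢e₂

  makeSource-away : ∀ D {v} e → ¬ (v ≡ e₁ e ⊎ v ≡ e₂ e) → makeSource D v e ≡ D e
  makeSource-away D {v} e ¬end with v ≟ e₁ e | v ≟ e₂ e
  ... | yes v≡e₁ | _        = contradiction (inj₁ v≡e₁) ¬end
  ... | no _     | yes v≡e₂ = contradiction (inj₂ v≡e₂) ¬end
  ... | no _     | no _     = refl

  head-makeSource≢ : ∀ D v e → head G (makeSource D v) e ≢ v
  head-makeSource≢ D v e head≡v =
    head≢tail (makeSource D v) e (trans head≡v (sym (tail-makeSource D e end)))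
    where
    end : v ≡ e₁ e ⊎ v ≡ e₂ e
    end with head-tail-ends (makeSource D v) e
    ... | inj₁ (h≡e₁ , _) = inj₁ (trans (sym head≡v) h≡e₁)
    ... | inj₂ (h≡e₂ , _) = inj₂ (trans (sym head≡v) h≡e₂)

  makeSource-acyclic : ∀ {D} v → Acyclic G D → Acyclic G (makeSource D v)
  makeSource-acyclic {D} v acyclic a cycle with a ≟ v
  ... | yes a≡v = ends-outside-v cycle a≡v
    where
    ends-outside-v : ∀ {x y} → DPath G (makeSource D v) x y → y ≢ v
    ends-outside-v (step e)  = head-makeSource≢ D v e
    ends-outside-v (e ∷ᵈ p) = ends-outside-v p
  ... | no a≢v = acyclic a (avoiding-v a≢v cycle)
    where
    unchanged : ∀ e → tail G (makeSource D v) e ≢ v →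
                tail G D e ≡ tail G (makeSource D v) e × head G D e ≡ head G (makeSource D v) e
    unchanged e tail≢v = same-direction D (makeSource D v) e (sym (makeSource-away D e ¬end))
      where
      ¬end : ¬ (v ≡ e₁ e ⊎ v ≡ e₂ e)
      ¬end end = tail≢v (tail-makeSource D e end)
    avoiding-v : ∀ {x y} → x ≢ v → DPath G (makeSource D v) x y → DPath G D x y
    avoiding-v x≢v (step e) with unchanged e x≢v
    ... | t≡ , h≡ = subst₂ (DPath G D) t≡ h≡ (step e)
    avoiding-v x≢v (e ∷ᵈ p) with unchanged e x≢v
    ... | t≡ , h≡ = subst (λ x → DPath G D x _) t≡
                      (e ∷ᵈ subst (λ x → DPath G D x _) (sym h≡) (avoiding-v (head-makeSource≢ D v e) p))

  out-edges⇒cycle : ∀ D → (∀ v → ∃ λ e → tail G D e ≡ v) → V → ∃ λ v → DPath G D v v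
  out-edges⇒cycle D out v₀ = repeated-vertex⇒cycle (pigeonhole (ℕ.n<1+n n) (λ i → walk (toℕ i)))
    where
    walk : ℕ → V
    walk zero    = v₀
    walk (suc k) = head G D (proj₁ (out (walk k)))
    path : ∀ d k → DPath G D (walk k) (walk (suc d + k))
    path zero    k = subst (λ x → DPath G D x (walk (suc k))) (proj₂ (out (walk k))) (step _)
    path (suc d) k = subst (λ x → DPath G D x (walk (suc (suc d + k)))) (proj₂ (out (walk k)))
      (_ ∷ᵈ subst (DPath G D (walk (suc k)) ∘ walk) (ℕ.+-suc (suc d) k) (path d (suc k)))
    repeated-vertex⇒cycle : (∃₂ λ i j → i Fin.< j × walk (toℕ i) ≡ walk (toℕ j)) → ∃ λ v → DPath G D v v
    repeated-vertex⇒cycle (i , j , i<j , walkᵢ≡walkⱼ) = walk (toℕ i) ,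
      subst (DPath G D (walk (toℕ i))) (trans (cong walk length≡j) (sym walkᵢ≡walkⱼ))
            (path (toℕ j ∸ suc (toℕ i)) (toℕ i))
      where
      length≡j : suc (toℕ j ∸ suc (toℕ i) + toℕ i) ≡ toℕ j
      length≡j = trans (sym (ℕ.+-suc _ (toℕ i))) (ℕ.m∸n+n≡m i<j)

  acyclic⇒sink : ∀ {D} → Acyclic G D → V → ∃ (IsSink D)
  acyclic⇒sink {D} acyclic v₀ with any? (λ v → all? (λ e → ¬? (tail G D e ≟ v)))
  ... | yes sink = sink
  ... | no ¬sink = contradiction (out-edges⇒cycle D out v₀) λ (v , cycle) → acyclic v cycle
    where
    out : ∀ v → ∃ λ e → tail G D e ≡ v
    out v with ¬∀⟶∃¬ m (λ e → tail G D e ≢ v) (λ e → ¬? (tail G D e ≟ v)) (λ sink → ¬sink (v , sink))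
    ... | e , ¬tail≢v = e , decidable-stable (tail G D e ≟ v) ¬tail≢v

  sink-head : ∀ D {v} → IsSink D v → ∀ e → v ≡ e₁ e ⊎ v ≡ e₂ e → head G D e ≡ v
  sink-head D sink e end with end⇒head⊎tail D e end
  ... | inj₁ v≡head = sym v≡head
  ... | inj₂ v≡tail = contradiction (sym v≡tail) (sink e)

  indeg-makeSource : ∀ D {v} → IsSink D v → ∀ {w} → w ≢ v → ∀ e →
                     [ w ≟ᵛ head G (makeSource D v) e ] ≡ [ w ≟ᵛ head G D e ] + joins v w e
  indeg-makeSource D {v} sink {w} w≢v e with (v ≟ e₁ e) ⊎-dec (v ≟ e₂ e)
  ... | yes end = sym (begin
    [ w ≟ᵛ head G D e ] + joins v w e
      ≡⟨ cong₂ _+_ (trans (cong (λ h → [ w ≟ᵛ h ]) (sink-head D sink e end)) (δ≡0 w≢v))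
                   (joins≡tail-head D′ v w e) ⟩
    [ v ≟ᵛ tail G D′ e ] * [ w ≟ᵛ head G D′ e ] + [ v ≟ᵛ head G D′ e ] * [ w ≟ᵛ tail G D′ e ]
      ≡⟨ cong₂ (λ a b → a * [ w ≟ᵛ head G D′ e ] + b * [ w ≟ᵛ tail G D′ e ])
               (δ≡1 (sym (tail-makeSource D e end))) (δ≡0 (≢-sym (head-makeSource≢ D v e))) ⟩
    1 * [ w ≟ᵛ head G D′ e ] + 0
      ≡⟨ trans (+-identityʳ _) (+-identityʳ _) ⟩
    [ w ≟ᵛ head G D′ e ] ∎)
    where
    open ≡-Reasoning
    D′ : Orientation G
    D′ = makeSource D v
  ... | no ¬end = begin
    [ w ≟ᵛ head G (makeSource D v) e ]
      ≡⟨ cong (λ h → [ w ≟ᵛ h ]) (proj₂ (same-direction (makeSource D v) D e (makeSource-away D e ¬end))) ⟩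
    [ w ≟ᵛ head G D e ]                  ≡⟨ +-identityʳ _ ⟨
    [ w ≟ᵛ head G D e ] + 0              ≡⟨ cong (λ a → [ w ≟ᵛ head G D e ] + a) joins≡0 ⟨
    [ w ≟ᵛ head G D e ] + joins v w e    ∎
    where
    open ≡-Reasoning
    joins≡0 : joins v w e ≡ 0
    joins≡0 = cong₂ (λ a b → a * [ w ≟ᵛ e₂ e ] + b * [ w ≟ᵛ e₁ e ])
                    (δ≡0 (¬end ∘ inj₁)) (δ≡0 (¬end ∘ inj₂))

  AcyclicIndegree : ChipDist G → Set
  AcyclicIndegree c = ∃ λ D → Acyclic G D × (∀ v → c v ≡ indeg G D v)

  fire-acyclicIndegree : ∀ {c v} → AcyclicIndegree c → Active G c v → AcyclicIndegree (fire G c v)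
  fire-acyclicIndegree {c} {v} (D , acyclic , c≡indeg) active =
    makeSource D v , makeSource-acyclic v acyclic , λ w → fired≡indeg w (w ≟ v)
    where
    open ≡-Reasoning
    sink : IsSink D v
    sink = deg≤indeg⇒sink D (subst (deg v ≤_) (c≡indeg v) active)
    fired≡indeg : ∀ w → Dec (w ≡ v) → fire G c v w ≡ indeg G (makeSource D v) w
    fired≡indeg .v (yes refl) = begin
      fire G c v v                  ≡⟨ fire-self c v ⟩
      c v ∸ deg v                   ≡⟨ cong (_∸ deg v) (trans (c≡indeg v) (sink⇒indeg≡deg D sink)) ⟩
      deg v ∸ deg v                 ≡⟨ ℕ.n∸n≡0 (deg v) ⟩
      0                             ≡⟨ Σ-zero (λ e → δ≡0 (≢-sym (head-makeSource≢ D v e))) ⟨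
      indeg G (makeSource D v) v    ∎
    fired≡indeg w (no w≢v) = begin
      fire G c v w                                    ≡⟨ fire-other c v w w≢v ⟩
      c w + edgesBetween G v w                        ≡⟨ cong₂ _+_ (c≡indeg w) (edgesBetween≡Σjoins v w) ⟩
      indeg G D w + Σ[ joins v w ]                    ≡⟨ ∑-distrib-+ (λ e → [ w ≟ᵛ head G D e ]) (joins v w) ⟨
      Σ[ (λ e → [ w ≟ᵛ head G D e ] + joins v w e) ]  ≡⟨ sum-cong-≗ (indeg-makeSource D sink w≢v) ⟨
      indeg G (makeSource D v) w                      ∎

  acyclicIndegree⇒nonTerminating : V → ∀ {c} → AcyclicIndegree c → NonTerminating G c
  acyclicIndegree⇒nonTerminating v₀ (D , acyclic , c≡indeg) _ done with acyclic⇒sink acyclic v₀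
  ... | v , sink = v , ≤-reflexive (sym (trans (c≡indeg v) (sink⇒indeg≡deg D sink)))
  acyclicIndegree⇒nonTerminating v₀ acyclicIndegree y (more (fires v active) c⇝y) =
    acyclicIndegree⇒nonTerminating v₀ (fire-acyclicIndegree acyclicIndegree active) y c⇝y

  -- Infinite games

  module LowerBound (connected : Connected G) (z : ChipDist G) (nonTerminating : NonTerminating G z) where

    N : ℕ
    N = Σ[ z ]

    recent : (V → ℕ) → V → ℕ
    recent stamp v = Σ[ (λ u → edgesBetween G v u * [ stamp v <ᵗ stamp u ]) ]

    -- The state after t legal firings from z.  stamp v is the step (counted from 1) at which v fired
    -- last, or 0 if it has not fired yet; fired v counts the firings of v.
    record Play (t : ℕ) : Set where
      field
        chips fired stamp : V → ℕ
        reached           : Reach G z chips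
        balance           : ∀ v → chips v + fired v * deg v ≡ z v + Σ[ (λ u → fired u * edgesBetween G u v) ]
        recent≤chips      : ∀ v → recent stamp v ≤ chips v
        stamp≤t           : ∀ v → stamp v ≤ t
        stamp-injective   : ∀ u v → 0 < stamp u → stamp u ≡ stamp v → u ≡ v
        fired⇒stamped     : ∀ v → 0 < fired v → 0 < stamp v
        Σfired            : Σ[ fired ] ≡ t

    start : Play 0
    start = record
      { chips           = z
      ; fired           = λ _ → 0
      ; stamp           = λ _ → 0
      ; reached         = done
      ; balance         = λ v → cong (z v +_) (sym (Σ-zero {n} {λ _ → 0} (λ _ → refl)))
      ; recent≤chips    = λ v → ≤-trans (≤-reflexive (Σ-zero (no-recent v))) z≤n
      ; stamp≤t         = λ _ → z≤n
      ; stamp-injective = λ _ _ ()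
      ; fired⇒stamped   = λ _ ()
      ; Σfired          = Σ-zero {n} {λ _ → 0} (λ _ → refl)
      }
      where
      no-recent : ∀ v u → edgesBetween G v u * [ 0 <ᵗ 0 ] ≡ 0
      no-recent v u = *-zeroʳ (edgesBetween G v u)

    module Fire {t} (p : Play t) (v : V) (active : Active G (Play.chips p) v) where
      open Play p

      chips′ fired′ stamp′ : V → ℕ
      chips′   = fire G chips v
      fired′ w = fired w + [ w ≟ᵛ v ]
      stamp′   = updateAt stamp v (λ _ → suc t)

      stamp′-self : stamp′ v ≡ suc t
      stamp′-self = updateAt-updates v stamp

      stamp′-other : ∀ {w} → w ≢ v → stamp′ w ≡ stamp w
      stamp′-other {w} w≢v = updateAt-minimal w v stamp w≢v

      stamp′≤t : ∀ {w} → w ≢ v → stamp′ w ≤ t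
      stamp′≤t {w} w≢v = ≤-trans (≤-reflexive (stamp′-other w≢v)) (stamp≤t w)

      fired′-other : ∀ {w} → w ≢ v → fired′ w ≡ fired w
      fired′-other {w} w≢v = trans (cong (fired w +_) (δ≡0 w≢v)) (+-identityʳ (fired w))

      balance′ : ∀ w → chips′ w + fired′ w * deg w ≡ z w + Σ[ (λ u → fired′ u * edgesBetween G u w) ]
      balance′ w = begin
        chips′ w + (fired w + δ) * deg w         ≡⟨ cong (chips′ w +_) (ℕ.*-distribʳ-+ (deg w) (fired w) δ) ⟩
        chips′ w + (fired w * deg w + δ * deg w) ≡⟨ cong (λ x → chips′ w + (fired w * deg w + x)) (δ*-subst w v deg) ⟩
        chips′ w + (fired w * deg w + δ * deg v) ≡⟨ x∙yz≈xz∙y (chips′ w) _ _ ⟩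
        chips′ w + δ * deg v + fired w * deg w   ≡⟨ cong (_+ fired w * deg w) (fire-equation chips v active w) ⟩
        chips w + new + fired w * deg w          ≡⟨ xy∙z≈xz∙y (chips w) _ _ ⟩
        chips w + fired w * deg w + new          ≡⟨ cong (_+ new) (balance w) ⟩
        z w + received + new                     ≡⟨ +-assoc (z w) received new ⟩
        z w + (received + new)                   ≡⟨ cong (λ x → z w + (received + x)) (Σ-δ* v (λ u → edgesBetween G u w)) ⟨
        z w + (received + Σ[ (λ u → [ u ≟ᵛ v ] * edgesBetween G u w) ])
          ≡⟨ cong (z w +_) (∑-distrib-+ (λ u → fired u * edgesBetween G u w) (λ u → [ u ≟ᵛ v ] * edgesBetween G u w)) ⟨
        z w + Σ[ (λ u → fired u * edgesBetween G u w + [ u ≟ᵛ v ] * edgesBetween G u w) ]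
          ≡⟨ cong (z w +_) (sum-cong-≗ (λ u → ℕ.*-distribʳ-+ (edgesBetween G u w) (fired u) [ u ≟ᵛ v ])) ⟨
        z w + Σ[ (λ u → fired′ u * edgesBetween G u w) ]
          ∎
        where
        open ≡-Reasoning
        δ new received : ℕ
        δ        = [ w ≟ᵛ v ]
        new      = edgesBetween G v w
        received = Σ[ (λ u → fired u * edgesBetween G u w) ]

      recent′-self : recent stamp′ v ≡ 0
      recent′-self = Σ-zero (λ u → nothing-later u (u ≟ v))
        where
        nothing-later : ∀ u → Dec (u ≡ v) → edgesBetween G v u * [ stamp′ v <ᵗ stamp′ u ] ≡ 0
        nothing-later .v (yes refl) = cong (_* [ stamp′ v <ᵗ stamp′ v ]) (edgesBetween-self v)
        nothing-later u  (no u≢v)   =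
          trans (cong (edgesBetween G v u *_) (≮⇒<ᵗ≡0 (ℕ.≤⇒≯ stamp′u≤stamp′v))) (*-zeroʳ (edgesBetween G v u))
          where
          stamp′u≤stamp′v : stamp′ u ≤ stamp′ v
          stamp′u≤stamp′v = ≤-trans (stamp′≤t u≢v) (≤-trans (ℕ.n≤1+n t) (≤-reflexive (sym stamp′-self)))

      recent′-other : ∀ {w} → w ≢ v → recent stamp′ w ≤ recent stamp w + edgesBetween G v w
      recent′-other {w} w≢v = begin
        recent stamp′ w
          ≤⟨ Σ-mono-≤ (λ u → one-more u (u ≟ v)) ⟩
        Σ[ (λ u → edgesBetween G w u * [ stamp w <ᵗ stamp u ] + [ u ≟ᵛ v ] * edgesBetween G w u) ]
          ≡⟨ ∑-distrib-+ (λ u → edgesBetween G w u * [ stamp w <ᵗ stamp u ]) (λ u → [ u ≟ᵛ v ] * edgesBetween G w u) ⟩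
        recent stamp w + Σ[ (λ u → [ u ≟ᵛ v ] * edgesBetween G w u) ]
          ≡⟨ cong (recent stamp w +_) (trans (Σ-δ* v (edgesBetween G w)) (edgesBetween-sym w v)) ⟩
        recent stamp w + edgesBetween G v w
          ∎
        where
        open ℕ.≤-Reasoning
        one-more : ∀ u → Dec (u ≡ v) → edgesBetween G w u * [ stamp′ w <ᵗ stamp′ u ]
                   ≤ edgesBetween G w u * [ stamp w <ᵗ stamp u ] + [ u ≟ᵛ v ] * edgesBetween G w u
        one-more .v (yes refl) = begin
          edgesBetween G w v * [ stamp′ w <ᵗ stamp′ v ]  ≤⟨ ℕ.*-monoʳ-≤ (edgesBetween G w v) (<ᵗ≤1 _ _) ⟩
          edgesBetween G w v * 1                          ≡⟨ *-identityʳ _ ⟩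
          edgesBetween G w v                              ≡⟨ ℕ.*-identityˡ _ ⟨
          1 * edgesBetween G w v                          ≡⟨ cong (_* edgesBetween G w v) (δ≡1 {i = v} refl) ⟨
          [ v ≟ᵛ v ] * edgesBetween G w v                 ≤⟨ ℕ.m≤n+m _ _ ⟩
          edgesBetween G w v * [ stamp w <ᵗ stamp v ] + [ v ≟ᵛ v ] * edgesBetween G w v ∎
        one-more u (no u≢v) rewrite stamp′-other w≢v | stamp′-other u≢v = ℕ.m≤m+n _ _

      recent≤chips′ : ∀ w → recent stamp′ w ≤ chips′ w
      recent≤chips′ w = by-cases (w ≟ v)
        where
        by-cases : Dec (w ≡ v) → recent stamp′ w ≤ chips′ w
        by-cases (yes refl) = ≤-trans (≤-reflexive recent′-self) z≤n
        by-cases (no w≢v)   = ≤-trans (recent′-other w≢v)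
          (≤-trans (+-monoˡ-≤ _ (recent≤chips w)) (≤-reflexive (sym (fire-other chips v w w≢v))))

      stamp′≤1+t : ∀ w → stamp′ w ≤ suc t
      stamp′≤1+t w with w ≟ v
      ... | yes refl = ≤-reflexive stamp′-self
      ... | no w≢v   = ≤-trans (stamp′≤t w≢v) (ℕ.n≤1+n t)

      fresh : ∀ u → suc t ≢ stamp u
      fresh u 1+t≡stamp = ℕ.1+n≰n (≤-trans (≤-reflexive 1+t≡stamp) (stamp≤t u))

      stamp′-injective : ∀ a b → 0 < stamp′ a → stamp′ a ≡ stamp′ b → a ≡ b
      stamp′-injective a b 0<stamp′a eq with a ≟ v | b ≟ v
      ... | yes a≡v | yes b≡v = trans a≡v (sym b≡v)
      ... | yes refl | no b≢v = contradiction (trans (sym stamp′-self) (trans eq (stamp′-other b≢v))) (fresh b)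
      ... | no a≢v | yes refl = contradiction (trans (sym stamp′-self) (trans (sym eq) (stamp′-other a≢v))) (fresh a)
      ... | no a≢v | no b≢v   = stamp-injective a b (subst (0 <_) (stamp′-other a≢v) 0<stamp′a)
                                  (trans (sym (stamp′-other a≢v)) (trans eq (stamp′-other b≢v)))

      fired′⇒stamped : ∀ w → 0 < fired′ w → 0 < stamp′ w
      fired′⇒stamped w 0<fired′ = by-cases (w ≟ v)
        where
        by-cases : Dec (w ≡ v) → 0 < stamp′ w
        by-cases (yes refl) = subst (0 <_) (sym stamp′-self) (s≤s z≤n)
        by-cases (no w≢v)   = subst (0 <_) (sym (stamp′-other w≢v))
                                (fired⇒stamped w (subst (0 <_) (fired′-other w≢v) 0<fired′))

      Σfired′ : Σ[ fired′ ] ≡ suc t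
      Σfired′ = trans (∑-distrib-+ fired (λ w → [ w ≟ᵛ v ])) (trans (cong₂ _+_ Σfired (Σ-δ v)) (+-comm t 1))

      next : Play (suc t)
      next = record
        { chips           = chips′
        ; fired           = fired′
        ; stamp           = stamp′
        ; reached         = reach-snoc reached (fires v active)
        ; balance         = balance′
        ; recent≤chips    = recent≤chips′
        ; stamp≤t         = stamp′≤1+t
        ; stamp-injective = stamp′-injective
        ; fired⇒stamped   = fired′⇒stamped
        ; Σfired          = Σfired′
        }

    play : ∀ t → Play t
    play zero    = start
    play (suc t) with nonTerminating (Play.chips (play t)) (Play.reached (play t))
    ... | v , active = Fire.next (play t) v active

    firing-bound : ∀ {u w} → Connects G u w → ℕ → ℕ
    firing-bound here              b = b
    firing-bound (there {u} _ path) b = firing-bound path (N + b * deg u)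

    K : ℕ
    K = Σ[ (λ u → Σ[ (λ w → firing-bound (connected u w) 0) ]) ]

    module Bounds {t} (p : Play t) where
      open Play p
      open ℕ.≤-Reasoning

      chips≤N : ∀ v → chips v ≤ N
      chips≤N v = ≤-trans (≤-Σ chips v) (≤-reflexive (Σ-reach reached))

      fired-neighbour : ∀ {a b} → Adj a b → fired b ≤ N + fired a * deg a
      fired-neighbour {a} {b} adj = begin
        fired b                                           ≡⟨ *-identityʳ (fired b) ⟨
        fired b * 1                                       ≤⟨ ℕ.*-monoʳ-≤ (fired b) (Adj⇒1≤edgesBetween adj) ⟩
        fired b * edgesBetween G b a                      ≤⟨ ≤-Σ (λ u → fired u * edgesBetween G u a) b ⟩
        Σ[ (λ u → fired u * edgesBetween G u a) ]         ≤⟨ ℕ.m≤n+m _ (z a) ⟩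
        z a + Σ[ (λ u → fired u * edgesBetween G u a) ]   ≡⟨ balance a ⟨
        chips a + fired a * deg a                         ≤⟨ +-monoˡ-≤ _ (chips≤N a) ⟩
        N + fired a * deg a                               ∎

      fired≤firing-bound : ∀ {u w} b → fired u ≤ b → (path : Connects G u w) → fired w ≤ firing-bound path b
      fired≤firing-bound b fired≤b here = fired≤b
      fired≤firing-bound {u} b fired≤b (there adj path) =
        fired≤firing-bound _ (≤-trans (fired-neighbour adj) (+-monoʳ-≤ N (ℕ.*-monoˡ-≤ (deg u) fired≤b))) path

      unfired⇒t≤K : ∀ u → fired u ≡ 0 → t ≤ K
      unfired⇒t≤K u fired≡0 = begin
        t                                              ≡⟨ Σfired ⟨
        Σ[ fired ]
          ≤⟨ Σ-mono-≤ (λ w → fired≤firing-bound 0 (≤-reflexive fired≡0) (connected u w)) ⟩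
        Σ[ (λ w → firing-bound (connected u w) 0) ]    ≤⟨ ≤-Σ (λ u → Σ[ (λ w → firing-bound (connected u w) 0) ]) u ⟩
        K                                              ∎

      all-stamped⇒∣E∣≤N : (∀ u → 0 < stamp u) → m ≤ N
      all-stamped⇒∣E∣≤N stamped = begin
        m                                                                 ≡⟨ Σ-one ⟨
        Σ[ (λ (_ : E) → 1) ]                                              ≤⟨ Σ-mono-≤ ends-ordered ⟩
        Σ[ (λ e → [ stamp (e₁ e) <ᵗ stamp (e₂ e) ] + [ stamp (e₂ e) <ᵗ stamp (e₁ e) ]) ]
          ≡⟨ handshake (λ a b → [ stamp a <ᵗ stamp b ]) ⟨
        Σ[ recent stamp ]                                                 ≤⟨ Σ-mono-≤ recent≤chips ⟩
        Σ[ chips ]                                                        ≡⟨ Σ-reach reached ⟩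
        N                                                                 ∎
        where
        ends-ordered : ∀ e → 1 ≤ [ stamp (e₁ e) <ᵗ stamp (e₂ e) ] + [ stamp (e₂ e) <ᵗ stamp (e₁ e) ]
        ends-ordered e = ≢⇒1≤<ᵗ+<ᵗ (λ eq → loopless e (stamp-injective (e₁ e) (e₂ e) (stamped (e₁ e)) eq))

    ∣E∣≤∣z∣ : m ≤ N
    ∣E∣≤∣z∣ = all-stamped⇒∣E∣≤N (λ u → fired⇒stamped u (ℕ.n≢0⇒n>0 (λ fired≡0 → ℕ.1+n≰n (unfired⇒t≤K u fired≡0))))
      where
      open Play (play (suc K))
      open Bounds (play (suc K))

proposition7 : (G : Graph) → Nonempty G → Connected G →
    (x : ChipDist G) →
    (∃ λ (D : Orientation G) → Acyclic G D × (∀ v → x v ≤ indeg G D v)) →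
    IsDist G x (∣E∣ G ∸ ∣_∣ G x)
proposition7 G v₀ connected x (D , acyclic , x≤indeg) = (y , ∣y∣≡∣E∣∸∣x∣ , x+y-nonTerminating) , minimal
  where
  y : ChipDist G
  y v = indeg G D v ∸ x v
  ∣y∣≡∣E∣∸∣x∣ : ∣_∣ G y ≡ ∣E∣ G ∸ ∣_∣ G x
  ∣y∣≡∣E∣∸∣x∣ = trans (Σ-∸ (indeg G D) x x≤indeg) (cong (_∸ Σ[ x ]) (Σ-indeg G D))
  x+y-nonTerminating : NonTerminating G (_⊕_ G x y)
  x+y-nonTerminating = acyclicIndegree⇒nonTerminating G v₀ (D , acyclic , λ v → ℕ.m+[n∸m]≡n (x≤indeg v))
  minimal : ∀ y′ → NonTerminating G (_⊕_ G x y′) → ∣E∣ G ∸ ∣_∣ G x ≤ ∣_∣ G y′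
  minimal y′ x+y′-nonTerminating = ℕ.m≤n+o⇒m∸n≤o (∣E∣ G) Σ[ x ]
    (≤-trans (LowerBound.∣E∣≤∣z∣ G connected _ x+y′-nonTerminating) (≤-reflexive (∑-distrib-+ x y′)))
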